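{- Let $(T,\mathcal{T},\vec{k})$ be an instance of MSTBL with $\mathcal{T}=\{T_1,\dots,T_n\}$, where the subtrees are numbered in the order in which they are considered by an execution of the algorithm BottomUpGreedy (described in the context), and let $\mathrm{ALG}$ be the output of that execution. For $i\in[0,n]$ let $\mathcal{T}_i=\{T_1,\dots,T_i\}$ and $\mathrm{ALG}_i=\mathrm{ALG}\cap\mathcal{T}_i$. Let $\mathrm{OPT}$ be an optimal solution of the instance. Then there exists a sequence $S_0,S_1,\dots,S_n$ of feasible subsets of $\mathcal{T}$ such that for every $i\in[0,n]$: \begin{enumerate} \item $S_i\setminus\mathcal{T}_i\subseteq\mathrm{OPT}$, \item $|\mathrm{OPT}|-|S_i|\le (M-1)\,|\mathrm{ALG}_i|$, and \item $S_i\cap\mathcal{T}_i=\mathrm{ALG}_i$. \end{enumerate}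
   Context: An object of a tree $T$ is a vertex or an edge. For a set $U$ of subtrees of $T$ and an object $o$, $\mathrm{load}(U,o)$ is the number of subtrees in $U$ containing $o$. An instance of MSTBL is a triple $(T,\mathcal{T},\vec{k})$ where $T$ is a tree, $\mathcal{T}$ is a set of subtrees of $T$ and $\vec{k}$ is a vector of non-negative integers indexed by the objects of $T$; a set $U\subseteq\mathcal{T}$ is feasible if $\mathrm{load}(U,o)\le k_o$ for every object $o$; the goal is a feasible $U$ of maximum cardinality (an optimal solution). $T$ is rooted at an arbitrary fixed vertex $r$; for a subtree $T_i$, $\mathrm{root}(T_i)$ is its vertex closest to $r$, $\mathrm{leaves}(T_i)$ is the number of leaves of $T_i$ other than $\mathrm{root}(T_i)$, and $M=\max_{T_i\in\mathcal{T}}\mathrm{leaves}(T_i)$. Algorithm BottomUpGreedy: set $U=\emptyset$; for every vertex $v$ of $T$ in some post-order traversal of $T$ (rooted at $r$), and for every subtree $T_i\in\mathcal{T}$ with $\mathrm{root}(T_i)=v$ (in an arbitrary order), if $U\cup\{T_i\}$ is feasible then replace $U$ by $U\cup\{T_i\}$; finally return $U$. -}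

module Defs where

open import Data.Nat using (ℕ; zero; suc; _+_; _*_; _∸_; _≤_; _<_; _<ᵇ_; _≡ᵇ_; _≤?_)
open import Data.Fin using (Fin; toℕ)
open import Data.Fin.Properties using (all?) renaming (_≟_ to _≟F_)
open import Data.Fin.Subset using (Subset; _∩_; _∪_; ⁅_⁆; ∣_∣) renaming (⊥ to ∅)
open import Data.Bool using (Bool; true; false; _∧_; _∨_; not; if_then_else_)
open import Data.Vec using (tabulate)
open import Data.List using (List; []; _∷_; _++_; [_]; foldl)
import Data.List.Base as LB
open import Data.List.Membership.Propositional using (_∈_)
open import Data.List.Relation.Unary.Unique.Propositional using (Unique)
open import Data.Product using (Σ; ∃; _×_; _,_)
open import Data.Empty using (⊥)
open import Function using (_⇔_; _∘_)
open import Relation.Nullary using (¬_; Dec; yes; no; does)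
open import Relation.Nullary.Decidable using (_×-dec_; _→-dec_; ¬?; isYes)
open import Relation.Binary.PropositionalEquality using (_≡_)

-- Vertices are Fin (suc m); the tree edges are {v , parent v} for v ≢ root.
-- Every vertex reaches the root by iterating parent, so the graph is a tree
-- (n vertices, n-1 edges, connected) and every tree rooted at r arises so.

iter : ∀ {A : Set} → (A → A) → ℕ → A → A
iter f zero x = x
iter f (suc k) x = f (iter f k x)

record RootedTree : Set where
  field
    m           : ℕ
    root        : Fin (suc m)
    parent      : Fin (suc m) → Fin (suc m)
    parent-root : parent root ≡ root
    reaches     : ∀ v → ∃ λ k → iter parent k v ≡ root

module _ (T : RootedTree) where
  open RootedTree T

  Vertex : Set
  Vertex = Fin (suc m)

  _==_ : Vertex → Vertex → Bool
  u == v = does (u ≟F v)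

  adj : Vertex → Vertex → Bool
  adj u v = (not (u == root) ∧ (parent u == v)) ∨ (not (v == root) ∧ (parent v == u))

  HasDepth : Vertex → ℕ → Set
  HasDepth v d = iter parent d v ≡ root × (∀ e → iter parent e v ≡ root → d ≤ e)

  data Walk (S : Vertex → Bool) : Vertex → Vertex → Set where
    here : ∀ {u} → Walk S u u
    step : ∀ {u v w} → adj u v ≡ true → S v ≡ true → Walk S v w → Walk S u w

  -- a subtree of T: a nonempty connected set of vertices (with all tree
  -- edges between its vertices)
  record Subtree : Set where
    field
      inV       : Vertex → Bool
      nonempty  : ∃ λ v → inV v ≡ true
      connected : ∀ u w → inV u ≡ true → inV w ≡ true → Walk inV u w

  open Subtree public

  inE : Subtree → Vertex → Bool
  inE S v = inV S v ∧ inV S (parent v)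

  IsRootOf : Subtree → Vertex → Set
  IsRootOf S v = inV S v ≡ true × (∀ u d e → inV S u ≡ true → HasDepth v d → HasDepth u e → d ≤ e)

  degIn : Subtree → Vertex → ℕ
  degIn S v = ∣ tabulate (λ u → inV S u ∧ adj u v) ∣

  Leaves : Subtree → ℕ → Set
  Leaves S ℓ = ∃ λ rt → IsRootOf S rt ×
    ℓ ≡ ∣ tabulate (λ v → inV S v ∧ (degIn S v ≡ᵇ 1) ∧ not (v == rt)) ∣

  IsChild : Vertex → Vertex → Set
  IsChild c v = ¬ (c ≡ root) × parent c ≡ v

  mutual
    data PostOrder : Vertex → List Vertex → Set where
      po : ∀ {v L} (cs : List Vertex) → Unique cs → (∀ c → c ∈ cs ⇔ IsChild c v) →
           PostOrders cs L → PostOrder v (L ++ [ v ])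
    data PostOrders : List Vertex → List Vertex → Set where
      []  : PostOrders [] []
      _∷_ : ∀ {c cs L₁ L₂} → PostOrder c L₁ → PostOrders cs L₂ → PostOrders (c ∷ cs) (L₁ ++ L₂)

  PostOrderTraversal : List Vertex → Set
  PostOrderTraversal L = PostOrder root L

  Before : List Vertex → Vertex → Vertex → Set
  Before L a b = ∃ λ xs → ∃ λ ys → ∃ λ zs → L ≡ xs ++ (a ∷ ys) ++ (b ∷ zs)

  -- MSTBL: family 𝒯 = {T_0 … T_{n-1}} (indexed by Fin n), capacities
  -- kv (vertices) and ke v (edge {v , parent v}, v ≢ root; ke root unused).
  module Instance {n : ℕ} (𝒯 : Fin n → Subtree) (kv ke : Vertex → ℕ) where

    loadV : Subset n → Vertex → ℕ
    loadV U v = ∣ U ∩ tabulate (λ i → inV (𝒯 i) v) ∣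

    loadE : Subset n → Vertex → ℕ
    loadE U v = ∣ U ∩ tabulate (λ i → inE (𝒯 i) v) ∣

    Feasible : Subset n → Set
    Feasible U = (∀ v → loadV U v ≤ kv v) × (∀ v → ¬ (v ≡ root) → loadE U v ≤ ke v)

    feasible? : (U : Subset n) → Dec (Feasible U)
    feasible? U = all? (λ v → loadV U v ≤? kv v)
             ×-dec all? (λ v → ¬? (v ≟F root) →-dec (loadE U v ≤? ke v))

    Optimal : Subset n → Set
    Optimal U = Feasible U × (∀ V → Feasible V → ∣ V ∣ ≤ ∣ U ∣)

    -- 𝒯_i = {T_1,…,T_i}: the first i subtrees (indices j with j < i)
    prefix : ℕ → Subset n
    prefix i = tabulate (λ j → toℕ j <ᵇ i)

    greedyStep : Subset n → Fin n → Subset n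
    greedyStep U i = if does (feasible? (U ∪ ⁅ i ⁆)) then U ∪ ⁅ i ⁆ else U

    bottomUpGreedy : Subset n
    bottomUpGreedy = foldl greedyStep ∅ (LB.tabulate (λ i → i))

    -- the index order is the order of an execution of BottomUpGreedy:
    -- roots appear in the order of some post-order traversal of T
    ExecutionOrder : Set
    ExecutionOrder = ∃ λ L → PostOrderTraversal L ×
      (∀ i j → toℕ i < toℕ j → ∀ u w → IsRootOf (𝒯 i) u → IsRootOf (𝒯 j) w → ¬ Before L w u)

    -- M = max_i leaves(T_i)   (0 if 𝒯 is empty)
    IsMaxLeaves : ℕ → Set
    IsMaxLeaves M = (∀ i ℓ → Leaves (𝒯 i) ℓ → ℓ ≤ M) ×
                    (∀ M' → (∀ i ℓ → Leaves (𝒯 i) ℓ → ℓ ≤ M') → M ≤ M')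

    Distinct : Set
    Distinct = ∀ i j → (∀ v → inV (𝒯 i) v ≡ inV (𝒯 j) v) → i ≡ j

module Submission where

-- Starting from S₀ = OPT, walk along the order of the algorithm and keep S_i agreeing
-- with ALG on T_1 … T_i.  If the algorithm rejects T_{i+1}, then S_i cannot contain it, since
-- ALG_i ∪ {T_{i+1}} ⊆ S_i would be feasible.  If it accepts T_{i+1} and S_i lacks it, add it and, for
-- each leaf ℓ of T_{i+1} (or for its root, if it is a single vertex), remove one later subtree of S_i
-- containing the lowest object on the path from ℓ to root(T_{i+1}) that S_i fills to capacity.  That
-- subtree is rooted no earlier than root(T_{i+1}) in post-order, hence contains the whole rest of the
-- path, and so frees every saturated object on it.  One subtree is added and at most max(M, 1) are
-- removed, which gives |OPT| − |S_i| ≤ (M − 1) |ALG_i|.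

open import Defs
open import Data.Nat using (ℕ; zero; suc; NonZero; _+_; _*_; _∸_; _≤_; _<_; z≤n; s≤s; s≤s⁻¹; _≤?_; _<?_; _<ᵇ_; _≡ᵇ_; z<s; s<s)
open import Data.Nat.Properties
open import Data.Fin using (Fin; toℕ; zero; suc; fromℕ<)
open import Data.Fin.Properties using (any?; toℕ-injective; toℕ-fromℕ<; toℕ<n) renaming (_≟_ to _≟F_)
open import Data.Fin.Subset using (Subset; _∈_; _∉_; _⊆_; _∩_; _∪_; _─_; ⁅_⁆; ∣_∣; inside; outside) renaming (⊥ to ∅)
open import Data.Fin.Subset.Properties
open import Data.Vec using (tabulate)
open import Data.Vec.Properties using (lookup∘tabulate; lookup⇒[]=; []=⇒lookup)
open import Data.Bool using (Bool; true; not; _∧_; if_then_else_)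
open import Data.Bool.Properties using (∨-zeroʳ; T-≡) renaming (_≟_ to _≟B_)
open import Data.Product using (∃; _×_; _,_; proj₁; proj₂)
open import Data.Sum using (_⊎_; inj₁; inj₂; [_,_]′)
open import Data.List using (List; []; _∷_; _++_; [_]; foldl)
open import Data.List.Properties using (++-assoc; foldl-++)
open import Data.List.Membership.Propositional using () renaming (_∈_ to _∈ˡ_)
open import Data.List.Membership.Propositional.Properties using (∈-++⁺ˡ; ∈-++⁺ʳ; ∈-∃++) renaming (∈-tabulate⁻ to ∈-tabulate⁻ˡ)
open import Data.List.Relation.Unary.Any using (here; there)
open import Function using (_⇔_; mk⇔; _∘_; id; Equivalence)
open import Function.Properties.Equivalence using () renaming (refl to ⇔-refl; trans to ⇔-trans)
open import Relation.Nullary using (¬_; Dec; yes; no; does; contradiction)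
open import Relation.Nullary.Decidable using (map′; _×-dec_; _⊎-dec_; ¬?; dec-true; dec-false)
open import Relation.Unary using (Pred; Decidable)
open import Relation.Binary.PropositionalEquality hiding ([_])

least : ∀ {p} {P : Pred ℕ p} → Decidable P → ∀ {k} → P k → ∃ λ t → P t × (∀ {u} → P u → t ≤ u)
least {P = P} P? {k} pk = search k 0 (λ ()) (subst P (sym (+-identityʳ k)) pk)
  where
  search : ∀ d i → (∀ {u} → u < i → ¬ P u) → P (d + i) → ∃ λ t → P t × (∀ {u} → P u → t ≤ u)
  search d i below p with P? i
  ... | yes pi = i , pi , λ pu → ≮⇒≥ λ u<i → below u<i pu
  search zero i below p | no ¬pi = contradiction p ¬pi
  search (suc d) i below p | no ¬pi = search d (suc i) below′ (subst P (sym (+-suc d i)) p)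
    where
    below′ : ∀ {u} → u < suc i → ¬ P u
    below′ u<1+i with m≤n⇒m<n∨m≡n (s≤s⁻¹ u<1+i)
    ... | inj₁ u<i = below u<i
    ... | inj₂ refl = ¬pi

argmax : ∀ {N p} {Q : Pred (Fin N) p} → Decidable Q → (f : Fin N → ℕ) → ∃ Q →
         ∃ λ x → Q x × (∀ {y} → Q y → f y ≤ f x)
argmax {suc N} Q? f (x₀ , qx₀) with any? (Q? ∘ suc)
argmax Q? f (zero , q₀)  | no ¬∃ = zero , q₀ , λ { {zero} _ → ≤-refl ; {suc y} qy → contradiction (y , qy) ¬∃ }
argmax Q? f (suc x , qx) | no ¬∃ = contradiction (x , qx) ¬∃
... | yes ∃s with argmax (Q? ∘ suc) (f ∘ suc) ∃s
...   | x , qx , max with Q? zero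
...     | no ¬q₀ = suc x , qx , λ { {zero} q₀ → contradiction q₀ ¬q₀ ; {suc y} qy → max qy }
...     | yes q₀ with f zero ≤? f (suc x)
...       | yes f₀≤ = suc x , qx , λ { {zero} _ → f₀≤ ; {suc y} qy → max qy }
...       | no f₀≰ = zero , q₀ , λ { {zero} _ → ≤-refl ; {suc y} qy → ≤-trans (max qy) (<⇒≤ (≰⇒> f₀≰)) }

bound-step : ∀ {c a a′ s s′ r o} → o ≤ c * a + s → suc s ≤ s′ + r → r ≤ suc c → suc a ≤ a′ → o ≤ c * a′ + s′
bound-step {c} {a} {a′} {s} {s′} {r} {o} o≤ s<s′+r r≤1+c 1+a≤a′ = begin
  o                  ≤⟨ o≤ ⟩
  c * a + s          ≤⟨ +-monoʳ-≤ (c * a) s≤s′+c ⟩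
  c * a + (s′ + c)   ≡⟨ cong (c * a +_) (+-comm s′ c) ⟩
  c * a + (c + s′)   ≡⟨ +-assoc (c * a) c s′ ⟨
  c * a + c + s′     ≡⟨ cong (_+ s′) (trans (+-comm (c * a) c) (sym (*-suc c a))) ⟩
  c * suc a + s′     ≤⟨ +-monoˡ-≤ s′ (*-monoʳ-≤ c 1+a≤a′) ⟩
  c * a′ + s′        ∎
  where
  open ≤-Reasoning
  s≤s′+c : s ≤ s′ + c
  s≤s′+c = s≤s⁻¹ (≤-trans s<s′+r (≤-trans (+-monoʳ-≤ s′ r≤1+c) (≤-reflexive (+-suc s′ c))))

module SubsetProperties where
  open import Data.Vec using ([]; _∷_; here; there)

  ∈-tabulate⁺ : ∀ {n} {f : Fin n → Bool} {x : Fin n} → f x ≡ true → x ∈ tabulate f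
  ∈-tabulate⁺ {f = f} {x} fx = lookup⇒[]= x _ (trans (lookup∘tabulate f x) fx)

  ∈-tabulate⁻ : ∀ {n} {f : Fin n → Bool} {x : Fin n} → x ∈ tabulate f → f x ≡ true
  ∈-tabulate⁻ {f = f} {x} x∈ = trans (sym (lookup∘tabulate f x)) ([]=⇒lookup x∈)

  x∈p─q⁻ : ∀ {n} (p q : Subset n) {x} → x ∈ p ─ q → x ∈ p × x ∉ q
  x∈p─q⁻ (inside ∷ p) (outside ∷ q) here = here , λ ()
  x∈p─q⁻ (outside ∷ p) (outside ∷ q) {zero} ()
  x∈p─q⁻ (s ∷ p) (inside ∷ q) {zero} ()
  x∈p─q⁻ (s ∷ p) (t ∷ q) (there x∈) with x∈p─q⁻ p q x∈
  ... | x∈p , x∉q = there x∈p , x∉q ∘ drop-there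

  ∣p∪q∣≤∣p∣+∣q∣ : ∀ {n} (p q : Subset n) → ∣ p ∪ q ∣ ≤ ∣ p ∣ + ∣ q ∣
  ∣p∪q∣≤∣p∣+∣q∣ [] [] = z≤n
  ∣p∪q∣≤∣p∣+∣q∣ (inside ∷ p) (t ∷ q) = s≤s (≤-trans (∣p∪q∣≤∣p∣+∣q∣ p q) (+-monoʳ-≤ ∣ p ∣ (∣p∣≤∣x∷p∣ t q)))
  ∣p∪q∣≤∣p∣+∣q∣ (outside ∷ p) (inside ∷ q) = subst (suc ∣ p ∪ q ∣ ≤_) (sym (+-suc ∣ p ∣ ∣ q ∣)) (s≤s (∣p∪q∣≤∣p∣+∣q∣ p q))
  ∣p∪q∣≤∣p∣+∣q∣ (outside ∷ p) (outside ∷ q) = ∣p∪q∣≤∣p∣+∣q∣ p q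

  ∉-witness : ∀ {n} (p q : Subset n) → ∣ q ∣ < ∣ p ∣ → ∃ λ x → x ∈ p × x ∉ q
  ∉-witness p q ∣q∣<∣p∣ with any? (λ x → x ∈? p ×-dec ¬? (x ∈? q))
  ... | yes w = w
  ... | no ¬w = contradiction (p⊆q⇒∣p∣≤∣q∣ p⊆q) (<⇒≱ ∣q∣<∣p∣)
    where
    p⊆q : p ⊆ q
    p⊆q {x} x∈p with x ∈? q
    ... | yes x∈q = x∈q
    ... | no x∉q = contradiction (x , x∈p , x∉q) ¬w

  ⋃ᶠ : ∀ {a n} → Subset a → (Fin a → Subset n) → Subset n
  ⋃ᶠ [] f = ∅
  ⋃ᶠ (inside ∷ P) f = f zero ∪ ⋃ᶠ P (f ∘ suc)
  ⋃ᶠ (outside ∷ P) f = ⋃ᶠ P (f ∘ suc)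

  x∈⋃ᶠ⁺ : ∀ {a n} (P : Subset a) (f : Fin a → Subset n) {s x} → s ∈ P → x ∈ f s → x ∈ ⋃ᶠ P f
  x∈⋃ᶠ⁺ (inside ∷ P) f here x∈ = x∈p∪q⁺ (inj₁ x∈)
  x∈⋃ᶠ⁺ (inside ∷ P) f (there s∈) x∈ = x∈p∪q⁺ (inj₂ (x∈⋃ᶠ⁺ P (f ∘ suc) s∈ x∈))
  x∈⋃ᶠ⁺ (outside ∷ P) f (there s∈) x∈ = x∈⋃ᶠ⁺ P (f ∘ suc) s∈ x∈

  x∈⋃ᶠ⁻ : ∀ {a n} (P : Subset a) (f : Fin a → Subset n) {x} → x ∈ ⋃ᶠ P f → ∃ λ s → s ∈ P × x ∈ f s
  x∈⋃ᶠ⁻ [] f x∈ = contradiction x∈ ∉⊥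
  x∈⋃ᶠ⁻ (inside ∷ P) f x∈ with x∈p∪q⁻ (f zero) _ x∈
  ... | inj₁ x∈f₀ = zero , here , x∈f₀
  ... | inj₂ x∈⋃ with x∈⋃ᶠ⁻ P (f ∘ suc) x∈⋃
  ...   | s , s∈P , x∈fs = suc s , there s∈P , x∈fs
  x∈⋃ᶠ⁻ (outside ∷ P) f x∈ with x∈⋃ᶠ⁻ P (f ∘ suc) x∈
  ... | s , s∈P , x∈fs = suc s , there s∈P , x∈fs

  ∣⋃ᶠ∣≤c*∣P∣ : ∀ {a n c} (P : Subset a) (f : Fin a → Subset n) → (∀ {s} → s ∈ P → ∣ f s ∣ ≤ c) → ∣ ⋃ᶠ P f ∣ ≤ c * ∣ P ∣
  ∣⋃ᶠ∣≤c*∣P∣ {n = n} {c} [] f bound = ≤-reflexive (trans (∣⊥∣≡0 n) (sym (*-zeroʳ c)))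
  ∣⋃ᶠ∣≤c*∣P∣ {c = c} (inside ∷ P) f bound = begin
    ∣ f zero ∪ ⋃ᶠ P (f ∘ suc) ∣         ≤⟨ ∣p∪q∣≤∣p∣+∣q∣ (f zero) _ ⟩
    ∣ f zero ∣ + ∣ ⋃ᶠ P (f ∘ suc) ∣      ≤⟨ +-mono-≤ (bound here) (∣⋃ᶠ∣≤c*∣P∣ P (f ∘ suc) (bound ∘ there)) ⟩
    c + c * ∣ P ∣                       ≡⟨ *-suc c ∣ P ∣ ⟨
    c * suc ∣ P ∣                       ∎
    where open ≤-Reasoning
  ∣⋃ᶠ∣≤c*∣P∣ (outside ∷ P) f bound = ∣⋃ᶠ∣≤c*∣P∣ P (f ∘ suc) (bound ∘ there)


  ∣p∪⁅x⁆∣≤1+∣p∣ : ∀ {n} (p : Subset n) x → ∣ p ∪ ⁅ x ⁆ ∣ ≤ suc ∣ p ∣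
  ∣p∪⁅x⁆∣≤1+∣p∣ p x = ≤-trans (∣p∪q∣≤∣p∣+∣q∣ p ⁅ x ⁆) (≤-reflexive (trans (cong (∣ p ∣ +_) (∣⁅x⁆∣≡1 x)) (+-comm ∣ p ∣ 1)))

  -- (A ∪ {j}) ∩ C is strictly larger than A ∩ C, so S ∩ C, which is at least as large, escapes A.
  witness-outside : ∀ {n} (S A C : Subset n) {j c} → j ∉ A → j ∈ C →
                    ∣ (A ∪ ⁅ j ⁆) ∩ C ∣ ≤ c → c ≤ ∣ S ∩ C ∣ → ∃ λ x → x ∈ S × x ∈ C × x ∉ A
  witness-outside S A C {j} j∉A j∈C A+j≤c c≤S with ∉-witness (S ∩ C) (A ∩ C) (<-≤-trans (<-≤-trans A<A+j A+j≤c) c≤S)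
    where
    A<A+j : ∣ A ∩ C ∣ < ∣ (A ∪ ⁅ j ⁆) ∩ C ∣
    A<A+j = p⊂q⇒∣p∣<∣q∣ ((λ x∈ → let (x∈A , x∈C) = x∈p∩q⁻ A C x∈ in x∈p∩q⁺ (x∈p∪q⁺ (inj₁ x∈A) , x∈C)) ,
                         j , x∈p∩q⁺ (x∈p∪q⁺ (inj₂ (x∈⁅x⁆ j)) , j∈C) , λ j∈A∩C → j∉A (proj₁ (x∈p∩q⁻ A C j∈A∩C)))
  ... | x , x∈S∩C , x∉A∩C = let (x∈S , x∈C) = x∈p∩q⁻ S C x∈S∩C in x , x∈S , x∈C , λ x∈A → x∉A∩C (x∈p∩q⁺ (x∈A , x∈C))

  ∣p∣≤∣p─q∣+∣q∣ : ∀ {n} (p q : Subset n) → ∣ p ∣ ≤ ∣ p ─ q ∣ + ∣ q ∣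
  ∣p∣≤∣p─q∣+∣q∣ p q = ≤-trans (p⊆q⇒∣p∣≤∣q∣ p⊆p─q∪q) (∣p∪q∣≤∣p∣+∣q∣ (p ─ q) q)
    where
    p⊆p─q∪q : p ⊆ (p ─ q) ∪ q
    p⊆p─q∪q {x} x∈p with x ∈? q
    ... | yes x∈q = x∈p∪q⁺ (inj₂ x∈q)
    ... | no x∉q = x∈p∪q⁺ (inj₁ (x∈p∧x∉q⇒x∈p─q x∈p x∉q))

  x∈exchange⁻ : ∀ {n} (S X : Subset n) {j x} → x ∈ (S ∪ ⁅ j ⁆) ─ X → (x ∈ S × x ∉ X) ⊎ x ≡ j
  x∈exchange⁻ S X {j} x∈ with x∈p─q⁻ (S ∪ ⁅ j ⁆) X x∈
  ... | x∈S+j , x∉X with x∈p∪q⁻ S ⁅ j ⁆ x∈S+j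
  ...   | inj₁ x∈S = inj₁ (x∈S , x∉X)
  ...   | inj₂ x∈⁅j⁆ = inj₂ (x∈⁅y⁆⇒x≡y j x∈⁅j⁆)

  x∈exchange∩⁻ : ∀ {n} (S X C : Subset n) {j x} → x ∈ ((S ∪ ⁅ j ⁆) ─ X) ∩ C → (x ∈ S ∩ C × x ∉ X) ⊎ x ≡ j
  x∈exchange∩⁻ S X C x∈ with x∈p∩q⁻ _ C x∈
  ... | x∈S′ , x∈C = [ (λ (x∈S , x∉X) → inj₁ (x∈p∩q⁺ (x∈S , x∈C) , x∉X)) , inj₂ ]′ (x∈exchange⁻ S X x∈S′)

  exchange-load : ∀ {n} (S X C : Subset n) {j c} → X ⊆ S → ∣ S ∩ C ∣ ≤ c →
                  (j ∈ C → ∣ S ∩ C ∣ < c ⊎ ∃ λ x → x ∈ X × x ∈ C) → ∣ ((S ∪ ⁅ j ⁆) ─ X) ∩ C ∣ ≤ c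
  exchange-load S X C {j} X⊆S S≤c room-or-removal with j ∈? C
  ... | no j∉C = ≤-trans (p⊆q⇒∣p∣≤∣q∣ ⊆S) S≤c
    where
    ⊆S : ((S ∪ ⁅ j ⁆) ─ X) ∩ C ⊆ S ∩ C
    ⊆S y∈ = [ proj₁ , (λ { refl → contradiction (proj₂ (x∈p∩q⁻ _ C y∈)) j∉C }) ]′ (x∈exchange∩⁻ S X C y∈)
  ... | yes j∈C with room-or-removal j∈C
  ...   | inj₁ S<c = ≤-trans (p⊆q⇒∣p∣≤∣q∣ ⊆S+j) (≤-trans (∣p∪⁅x⁆∣≤1+∣p∣ (S ∩ C) j) S<c)
    where
    ⊆S+j : ((S ∪ ⁅ j ⁆) ─ X) ∩ C ⊆ (S ∩ C) ∪ ⁅ j ⁆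
    ⊆S+j y∈ = [ x∈p∪q⁺ ∘ inj₁ ∘ proj₁ , (λ { refl → x∈p∪q⁺ (inj₂ (x∈⁅x⁆ j)) }) ]′ (x∈exchange∩⁻ S X C y∈)
  ...   | inj₂ (x , x∈X , x∈C) = ≤-trans (p⊆q⇒∣p∣≤∣q∣ ⊆S-x+j)
          (≤-trans (∣p∪⁅x⁆∣≤1+∣p∣ ((S ∩ C) ─ ⁅ x ⁆) j) (≤-trans (x∈p⇒∣p-x∣<∣p∣ (x∈p∩q⁺ (X⊆S x∈X , x∈C))) S≤c))
    where
    ⊆S-x+j : ((S ∪ ⁅ j ⁆) ─ X) ∩ C ⊆ ((S ∩ C) ─ ⁅ x ⁆) ∪ ⁅ j ⁆
    ⊆S-x+j y∈ = [ (λ (y∈S∩C , y∉X) → x∈p∪q⁺ (inj₁ (x∈p∧x≢y⇒x∈p-y y∈S∩C λ { refl → y∉X x∈X })))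
                , (λ { refl → x∈p∪q⁺ (inj₂ (x∈⁅x⁆ j)) }) ]′ (x∈exchange∩⁻ S X C y∈)

open SubsetProperties

∧-true⁻ : ∀ {a b} → a ∧ b ≡ true → a ≡ true × b ≡ true
∧-true⁻ {true} {true} _ = refl , refl

iter-+ : ∀ {A : Set} (f : A → A) a b x → iter f (a + b) x ≡ iter f a (iter f b x)
iter-+ f zero b x = refl
iter-+ f (suc a) b x = cong f (iter-+ f a b x)

iter-suc : ∀ {A : Set} (f : A → A) k x → iter f k (f x) ≡ iter f (suc k) x
iter-suc f zero x = refl
iter-suc f (suc k) x = cong f (iter-suc f k x)

module Tree (T : RootedTree) where
  open RootedTree T

  infix 4 _≼_ _≼?_

  _≼_ : Vertex T → Vertex T → Set
  x ≼ y = ∃ λ k → iter parent k x ≡ y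

  ≼-refl : ∀ {x} → x ≼ x
  ≼-refl = 0 , refl

  ≼-trans : ∀ {x y z} → x ≼ y → y ≼ z → x ≼ z
  ≼-trans {x} (a , refl) (b , refl) = b + a , iter-+ parent b a x

  ≼-parent : ∀ x → x ≼ parent x
  ≼-parent x = 1 , refl

  iter-root : ∀ k → iter parent k root ≡ root
  iter-root zero = refl
  iter-root (suc k) = trans (cong parent (iter-root k)) parent-root

  iter-beyond-root : ∀ {x r k} → iter parent r x ≡ root → r ≤ k → iter parent k x ≡ root
  iter-beyond-root {x} {r} {k} atRoot r≤k = begin
    iter parent k x                       ≡⟨ cong (λ t → iter parent t x) (m∸n+n≡m r≤k) ⟨
    iter parent (k ∸ r + r) x             ≡⟨ iter-+ parent (k ∸ r) r x ⟩
    iter parent (k ∸ r) (iter parent r x) ≡⟨ cong (iter parent (k ∸ r)) atRoot ⟩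
    iter parent (k ∸ r) root              ≡⟨ iter-root (k ∸ r) ⟩
    root                                  ∎
    where open ≡-Reasoning

  iter-cycle : ∀ {x} c → iter parent c x ≡ x → ∀ t → iter parent (t * c) x ≡ x
  iter-cycle c cyc zero = refl
  iter-cycle {x} c cyc (suc t) = trans (iter-+ parent c (t * c) x)
    (trans (cong (iter parent c) (iter-cycle c cyc t)) cyc)

  -- A nontrivial cycle x → … → x would force x to be the root (it is reached after r * c ≥ r steps).
  ≼-antisym : ∀ {x y} → x ≼ y → y ≼ x → x ≡ y
  ≼-antisym (zero , refl) _ = refl
  ≼-antisym {x} {y} (suc a , xy) (b , yx) = trans x≡root (sym y≡root)
    where
    c = b + suc a
    cyc : iter parent c x ≡ x
    cyc = trans (iter-+ parent b (suc a) x) (trans (cong (iter parent b) xy) yx)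
    r = proj₁ (reaches x)
    x≡root : x ≡ root
    x≡root = trans (sym (iter-cycle c cyc r))
      (iter-beyond-root (proj₂ (reaches x)) (m≤m*n r c ⦃ subst NonZero (sym (+-suc b a)) _ ⦄))
    y≡root : y ≡ root
    y≡root = trans (sym xy) (trans (cong (iter parent (suc a)) x≡root) (iter-root (suc a)))

  ≼-iter : ∀ {x a b} → a ≤ b → iter parent a x ≼ iter parent b x
  ≼-iter {x} {a} {b} a≤b = b ∸ a , trans (sym (iter-+ parent (b ∸ a) a x)) (cong (λ t → iter parent t x) (m∸n+n≡m a≤b))

  ≼-comparable : ∀ {x u v} → x ≼ u → x ≼ v → u ≼ v ⊎ v ≼ u
  ≼-comparable (a , refl) (b , refl) with ≤-total a b
  ... | inj₁ a≤b = inj₁ (≼-iter a≤b)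
  ... | inj₂ b≤a = inj₂ (≼-iter b≤a)

  -- Once the root is reached the walk stays there, so it suffices to search up to reaches x.
  _≼?_ : ∀ x y → Dec (x ≼ y)
  x ≼? y = map′ (λ (k , _ , xy) → k , xy) bounded (anyUpTo? (λ k → iter parent k x ≟F y) (suc r))
    where
    r = proj₁ (reaches x)
    bounded : x ≼ y → ∃ λ k → k < suc r × iter parent k x ≡ y
    bounded (k , xy) with k ≤? r
    ... | yes k≤r = k , s≤s k≤r , xy
    ... | no k≰r = r , ≤-refl , trans (proj₂ (reaches x)) (trans (sym (iter-beyond-root (proj₂ (reaches x)) (<⇒≤ (≰⇒> k≰r)))) xy)

  strict-child : ∀ {x y} → x ≼ y → x ≢ y → ∃ λ c → x ≼ c × IsChild T c y
  strict-child {x} {y} (k , xy) x≢y = go k xy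
    where
    go : ∀ k → iter parent k x ≡ y → ∃ λ c → x ≼ c × IsChild T c y
    go zero xy = contradiction xy x≢y
    go (suc k) xy with iter parent k x ≟F root
    ... | no c≢root = iter parent k x , (k , refl) , c≢root , xy
    ... | yes c≡root = go k (trans c≡root (trans (sym parent-root) (trans (cong parent (sym c≡root)) xy)))

  depth-spec : ∀ v → ∃ (HasDepth T v)
  depth-spec v with least (λ k → iter parent k v ≟F root) {proj₁ (reaches v)} (proj₂ (reaches v))
  ... | d , atRoot , minimal = d , atRoot , λ _ → minimal

  depth : Vertex T → ℕ
  depth v = proj₁ (depth-spec v)

  HasDepth⇒≡depth : ∀ {v d} → HasDepth T v d → d ≡ depth v
  HasDepth⇒≡depth {v} (atRoot , minimal) with proj₂ (depth-spec v)
  ... | atRoot′ , minimal′ = ≤-antisym (minimal _ atRoot′) (minimal′ _ atRoot)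

  depth-parent : ∀ {v} → v ≢ root → depth (parent v) < depth v
  depth-parent {v} v≢root with depth v | proj₂ (depth-spec v) | proj₂ (depth-spec (parent v))
  ... | zero  | atRoot , _ | _ = contradiction atRoot v≢root
  ... | suc d | atRoot , _ | _ , minimal = s≤s (minimal d (trans (iter-suc parent d v) atRoot))

  adj⇒ : ∀ {u v} → adj T u v ≡ true → (u ≢ root × parent u ≡ v) ⊎ (v ≢ root × parent v ≡ u)
  adj⇒ {u} {v} uv with u ≟F root | parent u ≟F v | v ≟F root | parent v ≟F u
  ... | no u≢root | yes pu | _ | _ = inj₁ (u≢root , pu)
  ... | _ | _ | no v≢root | yes pv = inj₂ (v≢root , pv)
  adj⇒ () | yes _ | _ | yes _ | _
  adj⇒ () | yes _ | _ | no _ | no _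
  adj⇒ () | no _ | no _ | yes _ | _
  adj⇒ () | no _ | no _ | no _ | no _

  adj⁺ : ∀ {u v} → v ≢ root → parent v ≡ u → adj T u v ≡ true
  adj⁺ {u} {v} v≢root pv rewrite dec-false (v ≟F root) v≢root | dec-true (parent v ≟F u) pv = ∨-zeroʳ _

  walk-exit : ∀ {P a b x} → Walk T P a b → P a ≡ true → a ≼ x → ¬ b ≼ x →
              P x ≡ true × x ≢ root × P (parent x) ≡ true
  walk-exit here Pa a≼x b⋠x = contradiction a≼x b⋠x
  walk-exit {P} {a} {x = x} (step {v = v} av Pv walk) Pa a≼x b⋠x with v ≼? x
  ... | yes v≼x = walk-exit walk Pv v≼x b⋠x
  ... | no v⋠x with adj⇒ av
  ...   | inj₂ (_ , pv≡a) = contradiction (≼-trans (1 , pv≡a) a≼x) v⋠x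
  ...   | inj₁ (a≢root , pa≡v) with a≼x
  ...     | zero , refl = Pa , a≢root , subst (λ w → P w ≡ true) (sym pa≡v) Pv
  ...     | suc k , pa≼x = contradiction (k , trans (cong (iter parent k) (sym pa≡v)) (trans (iter-suc parent k a) pa≼x)) v⋠x

  subtree-convex : ∀ (S : Subtree T) {u w x} → inV S u ≡ true → inV S w ≡ true → u ≼ x → x ≼ w → inV S x ≡ true
  subtree-convex S {u} {w} {x} Su Sw u≼x x≼w with x ≟F w
  ... | yes refl = Sw
  ... | no x≢w = proj₁ (walk-exit (connected S u w Su Sw) Su u≼x λ w≼x → x≢w (≼-antisym x≼w w≼x))

  IsRootOf⇒depth≤ : ∀ {S rt u} → IsRootOf T S rt → inV S u ≡ true → depth rt ≤ depth u
  IsRootOf⇒depth≤ {rt = rt} {u} (_ , minimal) Su = minimal u _ _ Su (proj₂ (depth-spec rt)) (proj₂ (depth-spec u))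

  root-exists : ∀ (S : Subtree T) → ∃ (IsRootOf T S)
  root-exists S with least (λ d → any? (λ v → (inV S v ≟B true) ×-dec (depth v ≟ d))) {depth v₀} (v₀ , Sv₀ , refl)
    where v₀ = proj₁ (nonempty S) ; Sv₀ = proj₂ (nonempty S)
  ... | _ , (rt , Srt , refl) , minimal = rt , Srt , λ u d e Su rt-d u-e →
        subst₂ _≤_ (sym (HasDepth⇒≡depth rt-d)) (sym (HasDepth⇒≡depth u-e)) (minimal (u , Su , refl))

  -- The root of S is the highest vertex of S, so leaving its subtree would climb above it inside S.
  ≼-root-of : ∀ (S : Subtree T) {rt u} → IsRootOf T S rt → inV S u ≡ true → u ≼ rt
  ≼-root-of S {rt} {u} R Su with u ≼? rt
  ... | yes u≼rt = u≼rt
  ... | no u⋠rt with walk-exit (connected S rt u (proj₁ R) Su) (proj₁ R) ≼-refl u⋠rt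
  ...   | _ , rt≢root , Sprt = contradiction (IsRootOf⇒depth≤ {S = S} R Sprt) (<⇒≱ (depth-parent rt≢root))

  Before-++ʳ : ∀ {L x y} R → Before T L x y → Before T (L ++ R) x y
  Before-++ʳ {x = x} {y} R (xs , ys , zs , refl) = xs , ys , zs ++ R ,
    trans (++-assoc xs ((x ∷ ys) ++ (y ∷ zs)) R) (cong (λ t → xs ++ x ∷ t) (++-assoc ys (y ∷ zs) R))

  Before-++ˡ : ∀ {L x y} P → Before T L x y → Before T (P ++ L) x y
  Before-++ˡ P (xs , ys , zs , refl) = P ++ xs , ys , zs , sym (++-assoc P xs _)

  mutual
    PostOrder-complete : ∀ {v L x} → PostOrder T v L → x ≼ v → x ∈ˡ L
    PostOrder-complete {v} {x = x} (po {L = L} cs _ children pos) x≼v with x ≟F v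
    ... | yes refl = ∈-++⁺ʳ L (here refl)
    ... | no x≢v with strict-child x≼v x≢v
    ...   | c , x≼c , c-child = ∈-++⁺ˡ (PostOrders-complete pos (Equivalence.from (children c) c-child) x≼c)

    PostOrders-complete : ∀ {cs L c x} → PostOrders T cs L → c ∈ˡ cs → x ≼ c → x ∈ˡ L
    PostOrders-complete (p ∷ ps) (here refl) x≼c = ∈-++⁺ˡ (PostOrder-complete p x≼c)
    PostOrders-complete (_∷_ {L₁ = L₁} p ps) (there c∈) x≼c = ∈-++⁺ʳ L₁ (PostOrders-complete ps c∈ x≼c)

  mutual
    PostOrder-before : ∀ {v L x y} → PostOrder T v L → y ≼ v → x ≼ y → x ≢ y → Before T L x y
    PostOrder-before {v} {x = x} {y} (po cs _ children pos) y≼v x≼y x≢y with y ≟F v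
    ... | yes refl with strict-child x≼y x≢y
    ...   | c , x≼c , c-child with ∈-∃++ (PostOrders-complete pos (Equivalence.from (children c) c-child) x≼c)
    ...     | xs , ys , refl = xs , ys , [] , ++-assoc xs (x ∷ ys) [ y ]
    PostOrder-before {v} (po cs _ children pos) y≼v x≼y x≢y | no y≢v with strict-child y≼v y≢v
    ...   | c , y≼c , c-child = Before-++ʳ [ v ] (PostOrders-before pos (Equivalence.from (children c) c-child) y≼c x≼y x≢y)

    PostOrders-before : ∀ {cs L c x y} → PostOrders T cs L → c ∈ˡ cs → y ≼ c → x ≼ y → x ≢ y → Before T L x y
    PostOrders-before (_∷_ {L₂ = L₂} p ps) (here refl) y≼c x≼y x≢y = Before-++ʳ L₂ (PostOrder-before p y≼c x≼y x≢y)
    PostOrders-before (_∷_ {L₁ = L₁} p ps) (there c∈) y≼c x≼y x≢y = Before-++ˡ L₁ (PostOrders-before ps c∈ y≼c x≼y x≢y)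

  -- rtS and w are both above v; were rtS strictly below w, it would precede rt in post-order.
  -- So w lies between v and rtS, and convexity applies.
  path-to-root-⊆ : ∀ {L} → PostOrderTraversal T L → ∀ (S : Subtree T) {rtS rt v w} →
                   IsRootOf T S rtS → ¬ Before T L rtS rt → inV S v ≡ true → v ≼ w → w ≼ rt → inV S w ≡ true
  path-to-root-⊆ post S {rtS} {rt} {v} {w} R ¬before Sv v≼w w≼rt with ≼-comparable v≼w (≼-root-of S R Sv)
  ... | inj₁ w≼rtS = subtree-convex S Sv (proj₁ R) v≼w w≼rtS
  ... | inj₂ rtS≼w with rtS ≟F w
  ...   | yes refl = proj₁ R
  ...   | no rtS≢w = contradiction (PostOrder-before post (reaches rt) (≼-trans rtS≼w w≼rt) rtS≢rt) ¬before
    where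
    rtS≢rt : rtS ≢ rt
    rtS≢rt refl = rtS≢w (≼-antisym rtS≼w w≼rt)

  parent-≼ : ∀ {x y} → x ≼ y → x ≢ y → parent x ≼ y
  parent-≼ (zero , x≡y) x≢y = contradiction x≡y x≢y
  parent-≼ {x} (suc k , xy) _ = k , trans (iter-suc parent k x) xy

  degIn≡1 : ∀ (S : Subtree T) {d} → d ≢ root → inV S (parent d) ≡ true →
            (∀ {c} → c ≢ root → parent c ≡ d → inV S c ≢ true) → degIn T S d ≡ 1
  degIn≡1 S {d} d≢root Spd no-child = trans (cong ∣_∣ neighbours≡) (∣⁅x⁆∣≡1 (parent d))
    where
    neighbour : Vertex T → Bool
    neighbour u = inV S u ∧ adj T u d
    only-parent : tabulate neighbour ⊆ ⁅ parent d ⁆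
    only-parent u∈ with ∧-true⁻ (∈-tabulate⁻ {f = neighbour} u∈)
    ... | Su , ud with adj⇒ ud
    ...   | inj₁ (u≢root , pu≡d) = contradiction Su (no-child u≢root pu≡d)
    ...   | inj₂ (_ , pd≡u) = subst (_∈ ⁅ parent d ⁆) pd≡u (x∈⁅x⁆ (parent d))
    neighbours≡ : tabulate neighbour ≡ ⁅ parent d ⁆
    neighbours≡ = ⊆-antisym only-parent λ u∈ → ∈-tabulate⁺ {f = neighbour}
      (subst (λ w → neighbour w ≡ true) (sym (x∈⁅y⁆⇒x≡y (parent d) u∈)) (cong₂ _∧_ Spd (adj⁺ d≢root refl)))

  leafSet : Subtree T → Vertex T → Subset (suc m)
  leafSet S rt = tabulate (λ v → inV S v ∧ (degIn T S v ≡ᵇ 1) ∧ not (_==_ T v rt))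

  -- The deepest vertex of S below v has no child in S, so it is a leaf unless it is the root.
  leaf-below : ∀ (S : Subtree T) {rt v} → IsRootOf T S rt → inV S v ≡ true →
               v ≡ rt ⊎ ∃ λ ℓ → ℓ ∈ leafSet S rt × ℓ ≼ v
  leaf-below S {rt} {v} R Sv
    with argmax (λ u → (inV S u ≟B true) ×-dec (u ≼? v)) depth (v , Sv , ≼-refl)
  ... | d , (Sd , d≼v) , deepest with d ≟F rt
  ...   | yes refl = inj₁ (≼-antisym (≼-root-of S R Sv) d≼v)
  ...   | no d≢rt = inj₂ (d , ∈-tabulate⁺ {f = λ v → inV S v ∧ (degIn T S v ≡ᵇ 1) ∧ not (_==_ T v rt)} d-leaf , d≼v)
    where
    d≼rt : d ≼ rt
    d≼rt = ≼-root-of S R Sd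
    d≢root : d ≢ root
    d≢root refl = d≢rt (trans (sym (iter-root (proj₁ d≼rt))) (proj₂ d≼rt))
    degree-1 : degIn T S d ≡ 1
    degree-1 = degIn≡1 S d≢root (subtree-convex S Sd (proj₁ R) (≼-parent d) (parent-≼ d≼rt d≢rt))
      λ {c} c≢root pc≡d Sc → <⇒≱ (subst (λ w → depth w < depth c) pc≡d (depth-parent c≢root))
                                  (deepest (Sc , ≼-trans (1 , pc≡d) d≼v))
    d-leaf : inV S d ∧ (degIn T S d ≡ᵇ 1) ∧ not (_==_ T d rt) ≡ true
    d-leaf rewrite Sd | degree-1 | dec-false (d ≟F rt) d≢rt = refl

tabulate-split : ∀ {A : Set} {N} (g : Fin N → A) (j : Fin N) → ∃ λ ps → ∃ λ qs →
  Data.List.tabulate g ≡ ps ++ g j ∷ qs ×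
  (∀ {a} → a ∈ˡ ps → ∃ λ i → toℕ i < toℕ j × a ≡ g i) ×
  (∀ {a} → a ∈ˡ qs → ∃ λ i → toℕ j < toℕ i × a ≡ g i)
tabulate-split {N = suc N} g zero = [] , Data.List.tabulate (g ∘ suc) , refl , (λ ()) ,
  λ a∈ → let (i , a≡) = ∈-tabulate⁻ˡ a∈ in suc i , z<s , a≡
tabulate-split {N = suc N} g (suc j) with tabulate-split (g ∘ suc) j
... | ps , qs , split , before , after = g zero ∷ ps , qs , cong (g zero ∷_) split ,
  (λ { (here refl) → zero , z<s , refl
     ; (there a∈) → let (i , i<j , a≡) = before a∈ in suc i , s<s i<j , a≡ }) ,
  λ a∈ → let (i , j<i , a≡) = after a∈ in suc i , s<s j<i , a≡

module Greedy (T : RootedTree) {n : ℕ} (𝒯 : Fin n → Subtree T) (kv ke : Vertex T → ℕ) where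
  open Instance T 𝒯 kv ke

  x∈prefix⁺ : ∀ {k x} → toℕ x < k → x ∈ prefix k
  x∈prefix⁺ {k} x<k = ∈-tabulate⁺ {f = λ i → toℕ i <ᵇ k} (Equivalence.to T-≡ (<⇒<ᵇ x<k))

  x∈prefix⁻ : ∀ {k x} → x ∈ prefix k → toℕ x < k
  x∈prefix⁻ {k} {x} x∈ = <ᵇ⇒< (toℕ x) k (Equivalence.from T-≡ (∈-tabulate⁻ {f = λ i → toℕ i <ᵇ k} x∈))

  containingV : Vertex T → Subset n
  containingV v = tabulate (λ i → inV (𝒯 i) v)

  containingE : Vertex T → Subset n
  containingE v = tabulate (λ i → inE T (𝒯 i) v)

  Feasible-⊆ : ∀ {U W} → U ⊆ W → Feasible W → Feasible U
  Feasible-⊆ {U} {W} U⊆W (vertex-load , edge-load) =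
    (λ v → ≤-trans (p⊆q⇒∣p∣≤∣q∣ (∩-⊆ (containingV v))) (vertex-load v)) ,
    (λ v v≢root → ≤-trans (p⊆q⇒∣p∣≤∣q∣ (∩-⊆ (containingE v))) (edge-load v v≢root))
    where
    ∩-⊆ : ∀ C → U ∩ C ⊆ W ∩ C
    ∩-⊆ C x∈ = let (x∈U , x∈C) = x∈p∩q⁻ U C x∈ in x∈p∩q⁺ (U⊆W x∈U , x∈C)

  greedyStep-cases : ∀ U i → Feasible (U ∪ ⁅ i ⁆) × greedyStep U i ≡ U ∪ ⁅ i ⁆ ⊎ ¬ Feasible (U ∪ ⁅ i ⁆) × greedyStep U i ≡ U
  greedyStep-cases U i with feasible? (U ∪ ⁅ i ⁆) in eq
  ... | yes f = inj₁ (f , cong (λ d → if does d then U ∪ ⁅ i ⁆ else U) eq)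
  ... | no ¬f = inj₂ (¬f , cong (λ d → if does d then U ∪ ⁅ i ⁆ else U) eq)

  greedyStep-other : ∀ U {i x} → x ≢ i → x ∈ greedyStep U i ⇔ x ∈ U
  greedyStep-other U {i} x≢i with greedyStep-cases U i
  ... | inj₂ (_ , eq) rewrite eq = ⇔-refl
  ... | inj₁ (_ , eq) rewrite eq = mk⇔ (λ x∈ → [ id , (λ x∈⁅i⁆ → contradiction (x∈⁅y⁆⇒x≡y i x∈⁅i⁆) x≢i) ]′ (x∈p∪q⁻ U ⁅ i ⁆ x∈))
                                       (x∈p∪q⁺ ∘ inj₁)

  greedyStep-self : ∀ {U i} → i ∉ U → i ∈ greedyStep U i ⇔ Feasible (U ∪ ⁅ i ⁆)
  greedyStep-self {U} {i} i∉U with greedyStep-cases U i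
  ... | inj₁ (f , eq) rewrite eq = mk⇔ (λ _ → f) (λ _ → x∈p∪q⁺ (inj₂ (x∈⁅x⁆ i)))
  ... | inj₂ (¬f , eq) rewrite eq = mk⇔ (λ i∈U → contradiction i∈U i∉U) (λ f → contradiction f ¬f)

  foldl-untouched : ∀ xs U {x} → ¬ x ∈ˡ xs → x ∈ foldl greedyStep U xs ⇔ x ∈ U
  foldl-untouched [] U x∉ = ⇔-refl
  foldl-untouched (i ∷ xs) U x∉ = ⇔-trans (foldl-untouched xs (greedyStep U i) (x∉ ∘ there))
                                          (greedyStep-other U (x∉ ∘ here))

  bottomUpGreedy-spec : ∀ j → j ∈ bottomUpGreedy ⇔ Feasible (bottomUpGreedy ∩ prefix (toℕ j) ∪ ⁅ j ⁆)
  bottomUpGreedy-spec j with tabulate-split id j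
  ... | ps , qs , split , before , after =
    subst (λ U → j ∈ bottomUpGreedy ⇔ Feasible (U ∪ ⁅ j ⁆)) state≡ (⇔-trans j∈ALG⇔ (greedyStep-self j∉state))
    where
    state : Subset n
    state = foldl greedyStep ∅ ps
    ALG≡ : bottomUpGreedy ≡ foldl greedyStep state (j ∷ qs)
    ALG≡ = trans (cong (foldl greedyStep ∅) split) (foldl-++ greedyStep ∅ ps (j ∷ qs))
    ∉before : ∀ {x} → ¬ toℕ x < toℕ j → ¬ x ∈ˡ ps
    ∉before x≮j x∈ = let (i , i<j , x≡i) = before x∈ in x≮j (subst (λ y → toℕ y < toℕ j) (sym x≡i) i<j)
    ∉after : ∀ {x} → toℕ x ≤ toℕ j → ¬ x ∈ˡ qs
    ∉after x≤j x∈ = let (i , j<i , x≡i) = after x∈ in <⇒≱ (subst (λ y → toℕ j < toℕ y) (sym x≡i) j<i) x≤j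
    late-∉state : ∀ {x} → ¬ toℕ x < toℕ j → x ∉ state
    late-∉state x≮j x∈ = ∉⊥ (Equivalence.to (foldl-untouched ps ∅ (∉before x≮j)) x∈)
    j∉state : j ∉ state
    j∉state = late-∉state (<-irrefl refl)
    j∈ALG⇔ : j ∈ bottomUpGreedy ⇔ j ∈ greedyStep state j
    j∈ALG⇔ = subst (λ U → j ∈ U ⇔ j ∈ greedyStep state j) (sym ALG≡) (foldl-untouched qs _ (∉after ≤-refl))
    early∈ALG⇔ : ∀ {x} → toℕ x < toℕ j → x ∈ bottomUpGreedy ⇔ x ∈ state
    early∈ALG⇔ {x} x<j = subst (λ U → x ∈ U ⇔ x ∈ state) (sym ALG≡) (foldl-untouched (j ∷ qs) state
      λ { (here refl) → <-irrefl refl x<j ; (there x∈) → ∉after (<⇒≤ x<j) x∈ })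
    state≡ : state ≡ bottomUpGreedy ∩ prefix (toℕ j)
    state≡ = ⊆-antisym state⊆ λ x∈ → let (x∈ALG , x∈prefix) = x∈p∩q⁻ _ _ x∈
                                     in Equivalence.to (early∈ALG⇔ (x∈prefix⁻ x∈prefix)) x∈ALG
      where
      state⊆ : state ⊆ bottomUpGreedy ∩ prefix (toℕ j)
      state⊆ {x} x∈ with toℕ x <? toℕ j
      ... | yes x<j = x∈p∩q⁺ (Equivalence.from (early∈ALG⇔ x<j) x∈ , x∈prefix⁺ x<j)
      ... | no x≮j = contradiction x∈ (late-∉state x≮j)

module Execution (T : RootedTree) {n : ℕ} (𝒯 : Fin n → Subtree T) (kv ke : Vertex T → ℕ)
  (L : List (Vertex T)) (post : PostOrderTraversal T L)
  (in-order : ∀ i j → toℕ i < toℕ j → ∀ u w → IsRootOf T (𝒯 i) u → IsRootOf T (𝒯 j) w → ¬ Before T L w u)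
  (M : ℕ) (leaves≤M : ∀ i ℓ → Leaves T (𝒯 i) ℓ → ℓ ≤ M)
  where
  open RootedTree T using (root; parent)
  open Instance T 𝒯 kv ke
  open Tree T
  open Greedy T 𝒯 kv ke

  -- A plays the role of ALG_k and j of the subtree considered next.
  module Exchange (j : Fin n) (S A : Subset n) (S-feasible : Feasible S) (A+j-feasible : Feasible (A ∪ ⁅ j ⁆))
    (j∉A : j ∉ A) (S─A-late : ∀ {x} → x ∈ S → x ∉ A → toℕ j < toℕ x) where

    rt : Vertex T
    rt = proj₁ (root-exists (𝒯 j))

    rt-root : IsRootOf T (𝒯 j) rt
    rt-root = proj₂ (root-exists (𝒯 j))

    -- Objects are indexed by vertices: v stands for the vertex v or for the edge {v , parent v}.
    Saturated : Vertex T → Set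
    Saturated v = inV (𝒯 j) v ≡ true ×
      (kv v ≤ loadV S v ⊎ v ≢ root × inV (𝒯 j) (parent v) ≡ true × ke v ≤ loadE S v)

    saturated? : ∀ v → Dec (Saturated v)
    saturated? v = (inV (𝒯 j) v ≟B true) ×-dec ((kv v ≤? loadV S v)
      ⊎-dec (¬? (v ≟F root) ×-dec ((inV (𝒯 j) (parent v) ≟B true) ×-dec (ke v ≤? loadE S v))))

    Late : Fin n → Set
    Late x = x ∈ S × toℕ j < toℕ x

    Covers : Fin n → Vertex T → Set
    Covers x v = ∀ {w} → v ≼ w → w ≼ rt → inV (𝒯 x) w ≡ true

    saturated-witness : ∀ {v} → Saturated v → ∃ λ x → x ∈ S × inV (𝒯 x) v ≡ true × x ∉ A
    saturated-witness {v} (jv , inj₁ kv≤)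
      with witness-outside S A (containingV v) j∉A (∈-tabulate⁺ {f = λ i → inV (𝒯 i) v} jv) (proj₁ A+j-feasible v) kv≤
    ... | x , x∈S , x∈C , x∉A = x , x∈S , ∈-tabulate⁻ {f = λ i → inV (𝒯 i) v} x∈C , x∉A
    saturated-witness {v} (jv , inj₂ (v≢root , jpv , ke≤))
      with witness-outside S A (containingE v) j∉A (∈-tabulate⁺ {f = λ i → inE T (𝒯 i) v} (cong₂ _∧_ jv jpv))
                           (proj₂ A+j-feasible v v≢root) ke≤
    ... | x , x∈S , x∈C , x∉A = x , x∈S , proj₁ (∧-true⁻ (∈-tabulate⁻ {f = λ i → inE T (𝒯 i) v} x∈C)) , x∉A

    saturated-covered : ∀ {v} → Saturated v → ∃ λ x → Late x × Covers x v
    saturated-covered sat with saturated-witness sat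
    ... | x , x∈S , xv , x∉A = x , (x∈S , j<x) , path-to-root-⊆ post (𝒯 x) x-root (in-order j x j<x rt _ rt-root x-root) xv
      where
      j<x = S─A-late x∈S x∉A
      x-root = proj₂ (root-exists (𝒯 x))

    -- Going up from s, the first saturated object is covered by a late subtree, which then covers the
    -- rest of the way to rt.  (The witnesses below are opaque: unfolding them makes type checking blow up.)
    opaque
      blocker : ∀ s → ∃ λ (Y : Subset n) → (∀ {x} → x ∈ Y → Late x) × ∣ Y ∣ ≤ 1 ×
                      (∀ {w} → Saturated w → s ≼ w → ∃ λ x → x ∈ Y × Covers x w)
      blocker s with any? (λ w → saturated? w ×-dec s ≼? w)
      ... | no none = ∅ , (λ x∈ → contradiction x∈ ∉⊥) , ≤-trans (≤-reflexive (∣⊥∣≡0 n)) z≤n ,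
                      λ sat s≼w → contradiction (_ , sat , s≼w) none
      ... | yes (w₀ , sat₀ , t₀ , s↑w₀) with least (saturated? ∘ λ t → iter parent t s) {t₀} (subst Saturated (sym s↑w₀) sat₀)
      ...   | t , sat , lowest with saturated-covered sat
      ...     | x , late , covers = ⁅ x ⁆ , (λ y∈ → subst Late (sym (x∈⁅y⁆⇒x≡y x y∈)) late) , ≤-reflexive (∣⁅x⁆∣≡1 x) ,
              λ { sat′ (t′ , refl) → x , x∈⁅x⁆ x , λ w≼w′ w′≼rt → covers (≼-trans (≼-iter {s} {b = t′} (lowest sat′)) w≼w′) w′≼rt }

    -- The leaves of T_j, or {rt} when T_j is a single vertex.
    opaque
      sources : ∃ λ (P : Subset (suc (RootedTree.m T))) → ∣ P ∣ ≤ suc (M ∸ 1) ×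
                  (∀ {w} → inV (𝒯 j) w ≡ true → ∃ λ s → s ∈ P × s ≼ w)
      sources with nonempty? (leafSet (𝒯 j) rt)
      ... | yes (ℓ₀ , ℓ₀∈) = leafSet (𝒯 j) rt , ≤-trans (leaves≤M j _ (rt , rt-root , refl)) (m≤n+m∸n M 1) , above
        where
        above : ∀ {w} → inV (𝒯 j) w ≡ true → ∃ λ s → s ∈ leafSet (𝒯 j) rt × s ≼ w
        above jw with leaf-below (𝒯 j) rt-root jw
        ... | inj₂ leaf = leaf
        ... | inj₁ refl = ℓ₀ , ℓ₀∈ , ≼-root-of (𝒯 j) rt-root (proj₁ (∧-true⁻ (∈-tabulate⁻
                            {f = λ v → inV (𝒯 j) v ∧ (degIn T (𝒯 j) v ≡ᵇ 1) ∧ not (_==_ T v rt)} ℓ₀∈)))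
      ... | no no-leaf = ⁅ rt ⁆ , ≤-trans (≤-reflexive (∣⁅x⁆∣≡1 rt)) (s≤s z≤n) , above
        where
        above : ∀ {w} → inV (𝒯 j) w ≡ true → ∃ λ s → s ∈ ⁅ rt ⁆ × s ≼ w
        above jw with leaf-below (𝒯 j) rt-root jw
        ... | inj₁ refl = rt , x∈⁅x⁆ rt , ≼-refl
        ... | inj₂ (ℓ , ℓ∈ , _) = contradiction (ℓ , ℓ∈) no-leaf

    opaque
      removed : Subset n
      removed = ⋃ᶠ (proj₁ sources) (proj₁ ∘ blocker)

      removed-late : ∀ {x} → x ∈ removed → Late x
      removed-late x∈ with x∈⋃ᶠ⁻ (proj₁ sources) (proj₁ ∘ blocker) x∈
      ... | s , _ , x∈Ys = proj₁ (proj₂ (blocker s)) x∈Ys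

      ∣removed∣≤ : ∣ removed ∣ ≤ suc (M ∸ 1)
      ∣removed∣≤ = ≤-trans (∣⋃ᶠ∣≤c*∣P∣ (proj₁ sources) (proj₁ ∘ blocker) λ {s} _ → proj₁ (proj₂ (proj₂ (blocker s))))
                           (≤-trans (≤-reflexive (*-identityˡ _)) (proj₁ (proj₂ sources)))

      removed-covers : ∀ {w} → Saturated w → ∃ λ x → x ∈ removed × Covers x w
      removed-covers sat with proj₂ (proj₂ sources) (proj₁ sat)
      ... | s , s∈P , s≼w with proj₂ (proj₂ (proj₂ (blocker s))) sat s≼w
      ...   | x , x∈Ys , covers = x , x∈⋃ᶠ⁺ (proj₁ sources) (proj₁ ∘ blocker) s∈P x∈Ys , covers

    exchange-feasible : Feasible ((S ∪ ⁅ j ⁆) ─ removed)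
    exchange-feasible = vertex-load , edge-load
      where
      removed⊆S : removed ⊆ S
      removed⊆S = proj₁ ∘ removed-late
      vertex-load : ∀ v → loadV ((S ∪ ⁅ j ⁆) ─ removed) v ≤ kv v
      vertex-load v = exchange-load S removed (containingV v) removed⊆S (proj₁ S-feasible v) room-or-removal
        where
        room-or-removal : j ∈ containingV v → loadV S v < kv v ⊎ ∃ λ x → x ∈ removed × x ∈ containingV v
        room-or-removal j∈ with ∈-tabulate⁻ {f = λ i → inV (𝒯 i) v} j∈ | kv v ≤? loadV S v
        ... | _ | no kv≰ = inj₁ (≰⇒> kv≰)
        ... | jv | yes kv≤ with removed-covers (jv , inj₁ kv≤)
        ...   | x , x∈ , covers = inj₂ (x , x∈ , ∈-tabulate⁺ {f = λ i → inV (𝒯 i) v} (covers ≼-refl (≼-root-of (𝒯 j) rt-root jv)))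
      edge-load : ∀ v → v ≢ root → loadE ((S ∪ ⁅ j ⁆) ─ removed) v ≤ ke v
      edge-load v v≢root = exchange-load S removed (containingE v) removed⊆S (proj₂ S-feasible v v≢root) room-or-removal
        where
        room-or-removal : j ∈ containingE v → loadE S v < ke v ⊎ ∃ λ x → x ∈ removed × x ∈ containingE v
        room-or-removal j∈ with ∧-true⁻ (∈-tabulate⁻ {f = λ i → inE T (𝒯 i) v} j∈) | ke v ≤? loadE S v
        ... | _ | no ke≰ = inj₁ (≰⇒> ke≰)
        ... | jv , jpv | yes ke≤ with removed-covers (jv , inj₂ (v≢root , jpv , ke≤))
        ...   | x , x∈ , covers = inj₂ (x , x∈ , ∈-tabulate⁺ {f = λ i → inE T (𝒯 i) v}
                  (cong₂ _∧_ (covers ≼-refl (≼-root-of (𝒯 j) rt-root jv)) (covers (≼-parent v) (≼-root-of (𝒯 j) rt-root jpv))))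

  module Construction (OPT : Subset n) (OPT-feasible : Feasible OPT) where

    record Invariant (k : ℕ) (S : Subset n) : Set where
      field
        feasible : Feasible S
        beyond⊆OPT : ∀ {x} → x ∈ S → k ≤ toℕ x → x ∈ OPT
        bound : ∣ OPT ∣ ≤ (M ∸ 1) * ∣ bottomUpGreedy ∩ prefix k ∣ + ∣ S ∣
        agrees : ∀ {x} → toℕ x < k → x ∈ S ⇔ x ∈ bottomUpGreedy

    invariant-zero : Invariant 0 OPT
    invariant-zero = record { feasible = OPT-feasible ; beyond⊆OPT = λ x∈ _ → x∈ ; bound = m≤n+m ∣ OPT ∣ _ ; agrees = λ () }

    module Step (j : Fin n) {S : Subset n} (inv : Invariant (toℕ j) S) where
      open Invariant inv

      A : Subset n
      A = bottomUpGreedy ∩ prefix (toℕ j)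

      A⊆S : A ⊆ S
      A⊆S x∈ = let (x∈ALG , x∈prefix) = x∈p∩q⁻ _ _ x∈ in Equivalence.from (agrees (x∈prefix⁻ x∈prefix)) x∈ALG

      j∉A : j ∉ A
      j∉A j∈A = <-irrefl refl (x∈prefix⁻ (proj₂ (x∈p∩q⁻ _ _ j∈A)))

      A⊆A′ : A ⊆ bottomUpGreedy ∩ prefix (suc (toℕ j))
      A⊆A′ x∈ = let (x∈ALG , x∈prefix) = x∈p∩q⁻ _ _ x∈ in x∈p∩q⁺ (x∈ALG , x∈prefix⁺ (m<n⇒m<1+n (x∈prefix⁻ x∈prefix)))

      late : j ∉ S → ∀ {x} → x ∈ S → x ∉ A → toℕ j < toℕ x
      late j∉S {x} x∈S x∉A = ≤∧≢⇒< (≮⇒≥ λ x<j → x∉A (x∈p∩q⁺ (Equivalence.to (agrees x<j) x∈S , x∈prefix⁺ x<j)))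
                                   λ j≡x → j∉S (subst (_∈ S) (sym (toℕ-injective j≡x)) x∈S)

      below-or-j : ∀ {x} → toℕ x < suc (toℕ j) → toℕ x < toℕ j ⊎ x ≡ j
      below-or-j x<1+j with m≤n⇒m<n∨m≡n (s≤s⁻¹ x<1+j)
      ... | inj₁ x<j = inj₁ x<j
      ... | inj₂ x≡j = inj₂ (toℕ-injective x≡j)

      greedy-rejects⇒∉ : j ∉ bottomUpGreedy → j ∉ S
      greedy-rejects⇒∉ j∉ALG j∈S = j∉ALG (Equivalence.from (bottomUpGreedy-spec j) (Feasible-⊆ A+j⊆S feasible))
        where
        A+j⊆S : A ∪ ⁅ j ⁆ ⊆ S
        A+j⊆S x∈ = [ A⊆S , (λ x∈⁅j⁆ → subst (_∈ S) (sym (x∈⁅y⁆⇒x≡y j x∈⁅j⁆)) j∈S) ]′ (x∈p∪q⁻ A ⁅ j ⁆ x∈)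

      keep : (j ∈ S ⇔ j ∈ bottomUpGreedy) → Invariant (suc (toℕ j)) S
      keep j∈⇔ = record
        { feasible = feasible
        ; beyond⊆OPT = λ x∈ j<x → beyond⊆OPT x∈ (<⇒≤ j<x)
        ; bound = ≤-trans bound (+-monoˡ-≤ ∣ S ∣ (*-monoʳ-≤ (M ∸ 1) (p⊆q⇒∣p∣≤∣q∣ A⊆A′)))
        ; agrees = λ x< → [ agrees , (λ { refl → j∈⇔ }) ]′ (below-or-j x<)
        }

      exchanged : j ∈ bottomUpGreedy → j ∉ S → ∃ (Invariant (suc (toℕ j)))
      exchanged j∈ALG j∉S = S′ , record
        { feasible = exchange-feasible ; beyond⊆OPT = beyond ; bound = bound′ ; agrees = agrees′ }
        where
        A+j-feasible : Feasible (A ∪ ⁅ j ⁆)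
        A+j-feasible = Equivalence.to (bottomUpGreedy-spec j) j∈ALG
        open Exchange j S A feasible A+j-feasible j∉A (late j∉S)
        S′ : Subset n
        S′ = (S ∪ ⁅ j ⁆) ─ removed

        beyond : ∀ {x} → x ∈ S′ → suc (toℕ j) ≤ toℕ x → x ∈ OPT
        beyond x∈ j<x = [ (λ (x∈S , _) → beyond⊆OPT x∈S (<⇒≤ j<x)) , (λ { refl → contradiction j<x (<-irrefl refl) }) ]′
                          (x∈exchange⁻ S removed x∈)

        bound′ : ∣ OPT ∣ ≤ (M ∸ 1) * ∣ bottomUpGreedy ∩ prefix (suc (toℕ j)) ∣ + ∣ S′ ∣
        bound′ = bound-step bound
          (≤-trans (p⊂q⇒∣p∣<∣q∣ (p⊆p∪q ⁅ j ⁆ , j , x∈p∪q⁺ (inj₂ (x∈⁅x⁆ j)) , j∉S)) (∣p∣≤∣p─q∣+∣q∣ (S ∪ ⁅ j ⁆) removed))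
          ∣removed∣≤
          (p⊂q⇒∣p∣<∣q∣ (A⊆A′ , j , x∈p∩q⁺ (j∈ALG , x∈prefix⁺ ≤-refl) , j∉A))

        j∈S′ : j ∈ S′
        j∈S′ = x∈p∧x∉q⇒x∈p─q (x∈p∪q⁺ (inj₂ (x∈⁅x⁆ j))) λ j∈R → <-irrefl refl (proj₂ (removed-late j∈R))

        earlier∈S′⇔ : ∀ {x} → toℕ x < toℕ j → x ∈ S′ ⇔ x ∈ S
        earlier∈S′⇔ x<j = mk⇔
          (λ x∈ → [ proj₁ , (λ { refl → contradiction x<j (<-irrefl refl) }) ]′ (x∈exchange⁻ S removed x∈))
          (λ x∈S → x∈p∧x∉q⇒x∈p─q (x∈p∪q⁺ (inj₁ x∈S)) λ x∈R → <-asym x<j (proj₂ (removed-late x∈R)))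

        agrees′ : ∀ {x} → toℕ x < suc (toℕ j) → x ∈ S′ ⇔ x ∈ bottomUpGreedy
        agrees′ x< = [ (λ x<j → ⇔-trans (earlier∈S′⇔ x<j) (agrees x<j)) , (λ { refl → mk⇔ (λ _ → j∈ALG) (λ _ → j∈S′) }) ]′
                       (below-or-j x<)

    invariant-suc : ∀ j {S} → Invariant (toℕ j) S → ∃ (Invariant (suc (toℕ j)))
    invariant-suc j {S} inv with j ∈? bottomUpGreedy | j ∈? S
    ... | yes j∈ALG | yes j∈S = S , keep (mk⇔ (λ _ → j∈ALG) (λ _ → j∈S))
      where open Step j inv
    ... | yes j∈ALG | no j∉S = exchanged j∈ALG j∉S
      where open Step j inv
    ... | no j∉ALG | _ = S , keep (mk⇔ (λ j∈S → contradiction j∈S (greedy-rejects⇒∉ j∉ALG)) (λ j∈ALG → contradiction j∈ALG j∉ALG))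
      where open Step j inv

    invariant : ∀ k → k ≤ n → ∃ (Invariant k)
    invariant zero _ = OPT , invariant-zero
    invariant (suc k) k<n with invariant k (<⇒≤ k<n)
    ... | S , inv = subst (λ t → ∃ (Invariant (suc t))) (toℕ-fromℕ< k<n)
                      (invariant-suc (fromℕ< k<n) (subst (λ t → Invariant t S) (sym (toℕ-fromℕ< k<n)) inv))

    Invariant⇒─prefix⊆OPT : ∀ {k S} → Invariant k S → S ─ prefix k ⊆ OPT
    Invariant⇒─prefix⊆OPT inv x∈ with x∈p─q⁻ _ _ x∈
    ... | x∈S , x∉prefix = Invariant.beyond⊆OPT inv x∈S (≮⇒≥ (x∉prefix ∘ x∈prefix⁺))

    Invariant⇒∩prefix≡ : ∀ {k S} → Invariant k S → S ∩ prefix k ≡ bottomUpGreedy ∩ prefix k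
    Invariant⇒∩prefix≡ {k} {S} inv = ⊆-antisym (transfer (Equivalence.to ∘ agree)) (transfer (Equivalence.from ∘ agree))
      where
      agree = Invariant.agrees inv
      transfer : ∀ {U V} → (∀ {x} → toℕ x < k → x ∈ U → x ∈ V) → U ∩ prefix k ⊆ V ∩ prefix k
      transfer U⇒V x∈ = let (x∈U , x∈prefix) = x∈p∩q⁻ _ _ x∈ in x∈p∩q⁺ (U⇒V (x∈prefix⁻ x∈prefix) x∈U , x∈prefix)

lemma1 : (T : RootedTree) {n : ℕ} (𝒯 : Fin n → Subtree T) (kv ke : Vertex T → ℕ) →
    let open Instance T 𝒯 kv ke in
    Distinct → ExecutionOrder →
    (M : ℕ) → IsMaxLeaves M →
    (OPT : Subset n) → Optimal OPT →
    ∃ λ (S : Fin (suc n) → Subset n) → ∀ (i : Fin (suc n)) →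
      Feasible (S i) ×
      (S i ─ prefix (toℕ i)) ⊆ OPT ×
      ∣ OPT ∣ ≤ (M ∸ 1) * ∣ bottomUpGreedy ∩ prefix (toℕ i) ∣ + ∣ S i ∣ ×
      S i ∩ prefix (toℕ i) ≡ bottomUpGreedy ∩ prefix (toℕ i)
lemma1 T {n} 𝒯 kv ke _ (L , post , in-order) M (leaves≤M , _) OPT (OPT-feasible , _) =
  S , λ i → let inv = proj₂ (invariant (toℕ i) (s≤s⁻¹ (toℕ<n i)))
            in Invariant.feasible inv , Invariant⇒─prefix⊆OPT inv , Invariant.bound inv , Invariant⇒∩prefix≡ inv
  where
  open Execution T 𝒯 kv ke L post in-order M leaves≤M
  open Construction OPT OPT-feasible
  S : Fin (suc n) → Subset n
  S i = proj₁ (invariant (toℕ i) (s≤s⁻¹ (toℕ<n i)))
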